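{- For every HyperLTL formula $\varphi$ of the form $\forall\pi_1\ldots\forall\pi_n\mathpunct{.}\phi$ that defines a hypersafety property, there exists a HyperLTL formula $\varphi'$ of the form $\forall\pi_1\ldots\forall\pi_n\mathpunct{.}\phi'$ that is equivalent to $\varphi$ (i.e., $T\models\varphi$ iff $T\models\varphi'$ for all $T\subseteq\Sigma^\omega$) and is temporal safety.
   Context: Fix a finite set $\mathit{AP}$ of atomic propositions and $\Sigma=2^{\mathit{AP}}$; traces are elements of $\Sigma^\omega$. HyperLTL: $\varphi ::= \exists\pi\mathpunct{.}\varphi \mid \forall\pi\mathpunct{.}\varphi \mid \phi$, $\phi ::= a_\pi \mid \neg\phi\mid\phi\wedge\phi\mid\mathsf{X}\phi\mid\phi\,\mathsf{U}\,\phi$ (closed); semantics w.r.t. a set of traces $T$ as usual. For $U\subseteq\Sigma^*$, $T\subseteq\Sigma^\omega$, $U\lessdot T$ means every $u\in U$ is a finite prefix of some $t\in T$. A hyperproperty $H$ is hypersafety if for every $T\notin H$ there is a finite $U\subseteq\Sigma^*$ with $U\lessdot T$ such that all $T'$ with $U\lessdot T'$ satisfy $T'\notin H$; $\varphi$ defines the hyperproperty $\{T\mid T\models\varphi\}$. A trace property $P$ is safety if every $t\notin P$ has a finite prefix $u$ such that no trace extending $u$ lies in $P$. A HyperLTL formula $Q_1\pi_1\ldots Q_n\pi_n\mathpunct{.}\phi$ is temporal safety if $\phi$, read as an LTL formula over $\mathit{AP}_{\pi_1}\cup\cdots\cup\mathit{AP}_{\pi_n}$ ($\mathit{AP}_\pi=\{a_\pi\mid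 a\in\mathit{AP}\}$), describes a safety property. -}

module Defs where

open import Data.Nat using (ℕ; zero; suc; _≤_; _<_)
open import Data.Fin using (Fin; toℕ)
import Data.Fin as Fin
open import Data.Fin.Subset using (Subset; _∈_)
open import Data.List using (List; length; lookup)
open import Data.List.Relation.Unary.All using (All)
open import Data.Product using (Σ; ∃; _×_)
open import Relation.Binary.PropositionalEquality using (_≡_)
open import Relation.Nullary using (¬_)

-- AP = Fin k ; Σ = 2^AP = Subset k ; traces = ℕ → Σ
Letter : ℕ → Set
Letter k = Subset k

Trace : ℕ → Set
Trace k = ℕ → Letter k

TraceSet : ℕ → Set₁
TraceSet k = Trace k → Set

IsPrefix : {A : Set} → List A → (ℕ → A) → Set
IsPrefix u t = (i : Fin (length u)) → lookup u i ≡ t (toℕ i)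

_⋖_ : {k : ℕ} → List (List (Letter k)) → TraceSet k → Set
U ⋖ T = All (λ u → ∃ λ t → T t × IsPrefix u t) U

Hypersafety : {k : ℕ} → (TraceSet k → Set) → Set₁
Hypersafety {k} H =
  (T : TraceSet k) → ¬ H T →
  ∃ λ (U : List (List (Letter k))) → U ⋖ T × ((T' : TraceSet k) → U ⋖ T' → ¬ H T')

Safety : {A : Set} → ((ℕ → A) → Set) → Set
Safety {A} P =
  (t : ℕ → A) → ¬ P t →
  ∃ λ (u : List A) → IsPrefix u t × ((t' : ℕ → A) → IsPrefix u t' → ¬ P t')

-- quantifier-free body over n trace variables (de Bruijn, Fin n)
data Body (k n : ℕ) : Set where
  atom : Fin k → Fin n → Body k n
  neg  : Body k n → Body k n
  and  : Body k n → Body k n → Body k n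
  next : Body k n → Body k n
  until : Body k n → Body k n → Body k n

-- LTL semantics of a body, read over AP_{π_1} ∪ … ∪ AP_{π_n}:
-- a letter is a function Fin n → Subset k (i.e. a subset of the disjoint union)
MultiLetter : ℕ → ℕ → Set
MultiLetter k n = Fin n → Letter k

_,_⊨ᴮ_ : {k n : ℕ} → (ℕ → MultiLetter k n) → ℕ → Body k n → Set
w , i ⊨ᴮ atom a π = a ∈ w i π
w , i ⊨ᴮ neg φ = ¬ (w , i ⊨ᴮ φ)
w , i ⊨ᴮ and φ ψ = (w , i ⊨ᴮ φ) × (w , i ⊨ᴮ ψ)
w , i ⊨ᴮ next φ = w , suc i ⊨ᴮ φ
w , i ⊨ᴮ until φ ψ =
  ∃ λ j → i ≤ j × (w , j ⊨ᴮ ψ) × ((l : ℕ) → i ≤ l → l < j → w , l ⊨ᴮ φ)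

data Hyper (k : ℕ) : ℕ → Set where
  body : {n : ℕ} → Body k n → Hyper k n
  ex   : {n : ℕ} → Hyper k (suc n) → Hyper k n
  all  : {n : ℕ} → Hyper k (suc n) → Hyper k n

extend : {k n : ℕ} → Trace k → (Fin n → Trace k) → Fin (suc n) → Trace k
extend t Π Fin.zero = t
extend t Π (Fin.suc j) = Π j

_,_⊨ᴴ_ : {k n : ℕ} → TraceSet k → (Fin n → Trace k) → Hyper k n → Set
_,_⊨ᴴ_ {k} T Π (body φ) = (λ i π → Π π i) , 0 ⊨ᴮ φ
_,_⊨ᴴ_ {k} T Π (ex φ) = ∃ λ t → T t × (T , extend t Π ⊨ᴴ φ)
_,_⊨ᴴ_ {k} T Π (all φ) = (t : Trace k) → T t → T , extend t Π ⊨ᴴ φ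

_⊨_ : {k : ℕ} → TraceSet k → Hyper k 0 → Set
T ⊨ φ = T , (λ ()) ⊨ᴴ φ

∀ⁿ : {k : ℕ} (n : ℕ) → Hyper k n → Hyper k 0
∀ⁿ zero φ = φ
∀ⁿ (suc n) φ = ∀ⁿ n (all φ)

TemporalSafeBody : {k n : ℕ} → Body k n → Set
TemporalSafeBody φ = Safety (λ w → w , 0 ⊨ᴮ φ)

-- Let φ' be the conjunction of φ[π ↦ τ π] over all reassignments τ : Fin n → Fin n of
-- the trace variables. A word w over AP_{π_1} ∪ … ∪ AP_{π_n} satisfies φ' iff the set of
-- its n component traces satisfies ∀ⁿ φ, and a set satisfies ∀ⁿ φ iff it satisfies ∀ⁿ φ'.
-- If w violates φ', hypersafety yields a finite set U of prefixes refuting the component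
-- set of w; U only inspects the first max |u| letters of w, so every word sharing that
-- prefix with w has a refuted component set and hence violates φ' as well.
module Submission where

open import Defs
open import Level using (0ℓ)
open import Axiom.ExcludedMiddle using (ExcludedMiddle)
open import Data.Nat using (ℕ; zero; suc; _≤_; _<_; s≤s)
open import Data.Nat.Properties using (<-≤-trans)
open import Data.Fin using (Fin; toℕ)
import Data.Fin as Fin
open import Data.Fin.Properties using (toℕ<n)
import Data.Fin.Subset as Subset
open import Data.Vec using (Vec; []; _∷_; lookup; tabulate)
open import Data.Vec.Properties using (lookup∘tabulate)
open import Data.List as List using (List; length; applyUpTo)
open import Data.List.Properties using (length-applyUpTo; lookup-applyUpTo)
open import Data.List.Extrema.Nat using (max; xs≤max)
open import Data.List.Relation.Unary.All using (All; []; _∷_)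
import Data.List.Relation.Unary.All.Properties as All
open import Data.Product using (∃; _×_; _,_; proj₁; proj₂)
open import Relation.Nullary using (¬_)
open import Function using (id; _∘_)
open import Function.Bundles using (_⇔_; mk⇔; Equivalence)
open import Relation.Binary.PropositionalEquality
  using (_≡_; refl; sym; trans; subst; cong; cong-app)

private
  variable
    k m n : ℕ

multiword : (Fin n → Trace k) → ℕ → MultiLetter k n
multiword Π i π = Π π i

component : (ℕ → MultiLetter k n) → Fin n → Trace k
component w π i = w i π

reindex : (Fin m → Fin n) → (ℕ → MultiLetter k n) → ℕ → MultiLetter k m
reindex σ w i π = w i (σ π)

components : (ℕ → MultiLetter k n) → TraceSet k
components w t = ∃ λ π → ∀ i → t i ≡ w i π

⊨ᴮ-cong : {w w' : ℕ → MultiLetter k n} → (∀ i π → w i π ≡ w' i π) →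
  ∀ φ i → w , i ⊨ᴮ φ → w' , i ⊨ᴮ φ
⊨ᴮ-cong w≗w' (atom a π) i h = subst (a Subset.∈_) (w≗w' i π) h
⊨ᴮ-cong w≗w' (neg φ) i h h' = h (⊨ᴮ-cong (λ i π → sym (w≗w' i π)) φ i h')
⊨ᴮ-cong w≗w' (and φ ψ) i (hφ , hψ) = ⊨ᴮ-cong w≗w' φ i hφ , ⊨ᴮ-cong w≗w' ψ i hψ
⊨ᴮ-cong w≗w' (next φ) i h = ⊨ᴮ-cong w≗w' φ (suc i) h
⊨ᴮ-cong w≗w' (until φ ψ) i (j , i≤j , hψ , hφ) =
  j , i≤j , ⊨ᴮ-cong w≗w' ψ j hψ , λ l i≤l l<j → ⊨ᴮ-cong w≗w' φ l (hφ l i≤l l<j)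

extend-cong : {Π Π' : Fin n → Trace k} (t : Trace k) → (∀ π i → Π π i ≡ Π' π i) →
  ∀ π i → extend t Π π i ≡ extend t Π' π i
extend-cong t Π≗Π' Fin.zero i = refl
extend-cong t Π≗Π' (Fin.suc π) i = Π≗Π' π i

⊨ᴴ-cong : {T : TraceSet k} {Π Π' : Fin n → Trace k} → (∀ π i → Π π i ≡ Π' π i) →
  ∀ ψ → T , Π ⊨ᴴ ψ → T , Π' ⊨ᴴ ψ
⊨ᴴ-cong Π≗Π' (body φ) h = ⊨ᴮ-cong (λ i π → Π≗Π' π i) φ 0 h
⊨ᴴ-cong Π≗Π' (ex ψ) (t , Tt , h) = t , Tt , ⊨ᴴ-cong (extend-cong t Π≗Π') ψ h
⊨ᴴ-cong Π≗Π' (all ψ) h t Tt = ⊨ᴴ-cong (extend-cong t Π≗Π') ψ (h t Tt)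

⊨∀ⁿ⇔ : (T : TraceSet k) (n : ℕ) (ψ : Hyper k n) →
  (T ⊨ ∀ⁿ n ψ) ⇔ ((Π : Fin n → Trace k) → (∀ π → T (Π π)) → T , Π ⊨ᴴ ψ)
⊨∀ⁿ⇔ T zero ψ = mk⇔ (λ h Π _ → ⊨ᴴ-cong (λ ()) ψ h) (λ h → h (λ ()) (λ ()))
⊨∀ⁿ⇔ {k = k} T (suc n) ψ = mk⇔ elim intro
  where
  open Equivalence (⊨∀ⁿ⇔ T n (all ψ))

  extend-head-tail : (Π : Fin (suc n) → Trace k) →
    ∀ π i → extend (Π Fin.zero) (Π ∘ Fin.suc) π i ≡ Π π i
  extend-head-tail Π Fin.zero i = refl
  extend-head-tail Π (Fin.suc π) i = refl

  elim : T ⊨ ∀ⁿ (suc n) ψ → (Π : Fin (suc n) → Trace k) → (∀ π → T (Π π)) → T , Π ⊨ᴴ ψ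
  elim h Π TΠ = ⊨ᴴ-cong (extend-head-tail Π) ψ
    (to h (Π ∘ Fin.suc) (TΠ ∘ Fin.suc) (Π Fin.zero) (TΠ Fin.zero))

  intro : ((Π : Fin (suc n) → Trace k) → (∀ π → T (Π π)) → T , Π ⊨ᴴ ψ) → T ⊨ ∀ⁿ (suc n) ψ
  intro h = from λ Π TΠ t Tt → h (extend t Π) λ { Fin.zero → Tt ; (Fin.suc π) → TΠ π }

rename : (Fin m → Fin n) → Body k m → Body k n
rename σ (atom a π) = atom a (σ π)
rename σ (neg φ) = neg (rename σ φ)
rename σ (and φ ψ) = and (rename σ φ) (rename σ ψ)
rename σ (next φ) = next (rename σ φ)
rename σ (until φ ψ) = until (rename σ φ) (rename σ ψ)

⊨-rename⁺ : ∀ (σ : Fin m → Fin n) (w : ℕ → MultiLetter k n) φ i →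
  reindex σ w , i ⊨ᴮ φ → w , i ⊨ᴮ rename σ φ
⊨-rename⁻ : ∀ (σ : Fin m → Fin n) (w : ℕ → MultiLetter k n) φ i →
  w , i ⊨ᴮ rename σ φ → reindex σ w , i ⊨ᴮ φ
⊨-rename⁺ σ w (atom a π) i h = h
⊨-rename⁺ σ w (neg φ) i h h' = h (⊨-rename⁻ σ w φ i h')
⊨-rename⁺ σ w (and φ ψ) i (hφ , hψ) = ⊨-rename⁺ σ w φ i hφ , ⊨-rename⁺ σ w ψ i hψ
⊨-rename⁺ σ w (next φ) i h = ⊨-rename⁺ σ w φ (suc i) h
⊨-rename⁺ σ w (until φ ψ) i (j , i≤j , hψ , hφ) =
  j , i≤j , ⊨-rename⁺ σ w ψ j hψ , λ l i≤l l<j → ⊨-rename⁺ σ w φ l (hφ l i≤l l<j)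
⊨-rename⁻ σ w (atom a π) i h = h
⊨-rename⁻ σ w (neg φ) i h h' = h (⊨-rename⁺ σ w φ i h')
⊨-rename⁻ σ w (and φ ψ) i (hφ , hψ) = ⊨-rename⁻ σ w φ i hφ , ⊨-rename⁻ σ w ψ i hψ
⊨-rename⁻ σ w (next φ) i h = ⊨-rename⁻ σ w φ (suc i) h
⊨-rename⁻ σ w (until φ ψ) i (j , i≤j , hψ , hφ) =
  j , i≤j , ⊨-rename⁻ σ w ψ j hψ , λ l i≤l l<j → ⊨-rename⁻ σ w φ l (hφ l i≤l l<j)

tautology : Body k n → Body k n
tautology φ = neg (and φ (neg φ))

⊨-tautology : (w : ℕ → MultiLetter k n) (i : ℕ) (φ : Body k n) → w , i ⊨ᴮ tautology φ
⊨-tautology w i φ (h , ¬h) = ¬h h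

-- Bodies have no constant ⊤, so a finite conjunction carries an explicit neutral element.
⋀ : Body k n → (p : ℕ) → (Fin p → Body k n) → Body k n
⋀ ε zero G = ε
⋀ ε (suc p) G = and (G Fin.zero) (⋀ ε p (G ∘ Fin.suc))

⋀ⱽ : Body k n → (m : ℕ) → (Vec (Fin n) m → Body k n) → Body k n
⋀ⱽ ε zero G = G []
⋀ⱽ {n = n} ε (suc m) G = ⋀ ε n λ π → ⋀ⱽ ε m (G ∘ (π ∷_))

module _ {w : ℕ → MultiLetter k n} {i : ℕ} {ε : Body k n} (⊨ε : w , i ⊨ᴮ ε) where

  ⊨⋀⇔ : ∀ p (G : Fin p → Body k n) → (w , i ⊨ᴮ ⋀ ε p G) ⇔ (∀ j → w , i ⊨ᴮ G j)
  ⊨⋀⇔ zero G = mk⇔ (λ _ ()) (λ _ → ⊨ε)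
  ⊨⋀⇔ (suc p) G = mk⇔
    (λ { (h₀ , hs) Fin.zero → h₀ ; (h₀ , hs) (Fin.suc j) → to hs j })
    (λ h → h Fin.zero , from (h ∘ Fin.suc))
    where open Equivalence (⊨⋀⇔ p (G ∘ Fin.suc))

  ⊨⋀ⱽ⇔ : ∀ m (G : Vec (Fin n) m → Body k n) → (w , i ⊨ᴮ ⋀ⱽ ε m G) ⇔ (∀ v → w , i ⊨ᴮ G v)
  ⊨⋀ⱽ⇔ zero G = mk⇔ (λ { h [] → h }) (λ h → h [])
  ⊨⋀ⱽ⇔ (suc m) G = mk⇔
    (λ { h (π ∷ v) → Equivalence.to (⊨⋀ⱽ⇔ m (G ∘ (π ∷_))) (Equivalence.to outer h π) v })
    (λ h → Equivalence.from outer λ π → Equivalence.from (⊨⋀ⱽ⇔ m (G ∘ (π ∷_))) (h ∘ (π ∷_)))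
    where
    outer : (w , i ⊨ᴮ ⋀ⱽ ε (suc m) G) ⇔ (∀ π → w , i ⊨ᴮ ⋀ⱽ ε m (G ∘ (π ∷_)))
    outer = ⊨⋀⇔ n λ π → ⋀ⱽ ε m (G ∘ (π ∷_))

closure : Body k n → Body k n
closure {n = n} φ = ⋀ⱽ (tautology φ) n λ v → rename (lookup v) φ

⊨closure⇔ : (w : ℕ → MultiLetter k n) (φ : Body k n) →
  (w , 0 ⊨ᴮ closure φ) ⇔ ((τ : Fin n → Fin n) → reindex τ w , 0 ⊨ᴮ φ)
⊨closure⇔ {n = n} w φ = mk⇔
  (λ h τ → ⊨ᴮ-cong (λ i π → cong (w i) (lookup∘tabulate τ π)) φ 0
     (⊨-rename⁻ (lookup (tabulate τ)) w φ 0 (to h (tabulate τ))))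
  (λ h → from λ v → ⊨-rename⁺ (lookup v) w φ 0 (h (lookup v)))
  where
  open Equivalence
    (⊨⋀ⱽ⇔ {ε = tautology φ} (⊨-tautology w 0 φ) n λ v → rename (lookup v) φ)

closure-equiv : (T : TraceSet k) (φ : Body k n) →
  (T ⊨ ∀ⁿ n (body φ)) ⇔ (T ⊨ ∀ⁿ n (body (closure φ)))
closure-equiv {n = n} T φ = mk⇔
  (λ h → ∀ⁿφ'.from λ Π TΠ → Equivalence.from (⊨closure⇔ (multiword Π) φ) λ τ →
     ∀ⁿφ.to h (Π ∘ τ) (TΠ ∘ τ))
  (λ h → ∀ⁿφ.from λ Π TΠ → Equivalence.to (⊨closure⇔ (multiword Π) φ) (∀ⁿφ'.to h Π TΠ) id)
  where
  module ∀ⁿφ = Equivalence (⊨∀ⁿ⇔ T n (body φ))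
  module ∀ⁿφ' = Equivalence (⊨∀ⁿ⇔ T n (body (closure φ)))

⊨closure⇔components : (w : ℕ → MultiLetter k n) (φ : Body k n) →
  (w , 0 ⊨ᴮ closure φ) ⇔ (components w ⊨ ∀ⁿ n (body φ))
⊨closure⇔components {n = n} w φ = mk⇔
  (λ h → Equivalence.from (⊨∀ⁿ⇔ (components w) n (body φ)) λ Π Π∈ →
     ⊨ᴮ-cong (λ i π → sym (proj₂ (Π∈ π) i)) φ 0
       (Equivalence.to (⊨closure⇔ w φ) h (proj₁ ∘ Π∈)))
  (λ h → Equivalence.to (⊨∀ⁿ⇔ (components w) n (body (closure φ)))
     (Equivalence.to (closure-equiv (components w) φ) h) (component w) λ π → π , λ i → refl)

IsPrefix-agree : {A : Set} {u : List A} {t t' : ℕ → A} →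
  IsPrefix u t → IsPrefix u t' → ∀ {i} → i < length u → t i ≡ t' i
IsPrefix-agree {u = x List.∷ u} u≺t u≺t' {zero} _ = trans (sym (u≺t Fin.zero)) (u≺t' Fin.zero)
IsPrefix-agree {u = x List.∷ u} u≺t u≺t' {suc i} (s≤s i<|u|) =
  IsPrefix-agree {u = u} (u≺t ∘ Fin.suc) (u≺t' ∘ Fin.suc) i<|u|

applyUpTo-agree : {A : Set} (t t' : ℕ → A) (l : ℕ) →
  IsPrefix (applyUpTo t l) t' → ∀ {i} → i < l → t i ≡ t' i
applyUpTo-agree t t' l ≺t' i<l =
  IsPrefix-agree {u = applyUpTo t l} (lookup-applyUpTo t l) ≺t'
    (subst (_ <_) (sym (length-applyUpTo t l)) i<l)

⋖-components : {w w' : ℕ → MultiLetter k n} {l : ℕ} →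
  (∀ {i} → i < l → w i ≡ w' i) →
  (U : List (List (Letter k))) → All (λ u → length u ≤ l) U →
  U ⋖ components w → U ⋖ components w'
⋖-components agree List.[] [] [] = []
⋖-components {w' = w'} agree (u List.∷ U) (|u|≤l ∷ lens) ((t , (π , t≗) , u≺t) ∷ rest) =
  (component w' π , (π , λ i → refl) , u≺w'π) ∷ ⋖-components agree U lens rest
  where
  u≺w'π : IsPrefix u (component w' π)
  u≺w'π j = trans (u≺t j)
    (trans (t≗ (toℕ j)) (cong-app (agree (<-≤-trans (toℕ<n j) |u|≤l)) π))

closure-safe : (φ : Body k n) → Hypersafety (λ T → T ⊨ ∀ⁿ n (body φ)) →
  TemporalSafeBody (closure φ)
closure-safe φ hypersafe w w⊭
  with hypersafe (components w) (w⊭ ∘ Equivalence.from (⊨closure⇔components w φ))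
... | U , U⋖ , refutes = applyUpTo w l , lookup-applyUpTo w l , bad-prefix
  where
  l : ℕ
  l = max 0 (List.map length U)

  bad-prefix : ∀ w' → IsPrefix (applyUpTo w l) w' → ¬ (w' , 0 ⊨ᴮ closure φ)
  bad-prefix w' ≺w' h = refutes (components w')
    (⋖-components (applyUpTo-agree w w' l ≺w') U (All.map⁻ (xs≤max 0 (List.map length U))) U⋖)
    (Equivalence.to (⊨closure⇔components w' φ) h)

proposition3p4 : ExcludedMiddle (Level.suc 0ℓ) →
    {k : ℕ} (n : ℕ) (φ : Body k n) →
    Hypersafety (λ T → T ⊨ ∀ⁿ n (body φ)) →
    ∃ λ (φ' : Body k n) →
    ((T : TraceSet k) → (T ⊨ ∀ⁿ n (body φ)) ⇔ (T ⊨ ∀ⁿ n (body φ')))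
    × TemporalSafeBody φ'
proposition3p4 _ n φ hypersafe = closure φ , (λ T → closure-equiv T φ) , closure-safe φ hypersafe
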